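{- Let $\Gamma=x_1:\rho_1,\dots,x_n:\rho_n$ and $\Delta$ be contexts, $t$ a term and $\tau$ a type with $\Gamma;\Delta\vdash t:\tau$. If $r_i\in[\![\rho_i]\!]$ for all $1\le i\le n$, then the simultaneous substitution $t[x_1:=r_1,\dots,x_n:=r_n]$ belongs to $[\![\tau]\!]$.
   Context: Calculus $\lambda^{::}_{\mathtt{catch}}$. Types: $\sigma,\tau,\rho ::= \mathtt{unit} \mid \mathtt{list}\,\tau \mid \sigma\to\tau$. A type is arrow-free if it contains no $\to$; $\psi$ ranges over arrow-free types. Terms: $t,r,s ::= x \mid () \mid \mathtt{nil} \mid (::) \mid \mathtt{lrec} \mid \lambda x.r \mid t\,s \mid \mathtt{catch}\,\alpha\,t \mid \mathtt{throw}\,\alpha\,t$ ($x$ variables, $\alpha,\beta$ continuation variables; $\lambda x$ binds $x$, $\mathtt{catch}\,\alpha$ binds $\alpha$; application left-associative; $t::r$ abbreviates $(::)\,t\,r$). $\mathrm{FCV}$ = free continuation variables; substitution is capture-avoiding. Values: $v,w ::= x \mid () \mid \mathtt{nil} \mid (::) \mid (::)\,v \mid (::)\,v\,w \mid \mathtt{lrec} \mid \mathtt{lrec}\,v \mid \mathtt{lrec}\,v\,w \mid \lambda x.r$. Contexts $E ::= \Box\,t \mid v\,\Box \mid \mathtt{throw}\,\alpha\,\Box$. Reduction $\to$ is the compatible closure of: $(\lambda x.t)\,v\to t[x:=v]$; $E[\mathtt{throw}\,\alpha\,t]\to\mathtt{throw}\,\alpha\,t$; $\mathtt{catch}\,\alpha\,(\mathtt{throw}\,\alpha\,t)\to\mathtt{catch}\,\alpha\,t$;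 $\mathtt{catch}\,\alpha\,(\mathtt{throw}\,\beta\,v)\to\mathtt{throw}\,\beta\,v$ if $\alpha\notin\{\beta\}\cup\mathrm{FCV}(v)$; $\mathtt{catch}\,\alpha\,v\to v$ if $\alpha\notin\mathrm{FCV}(v)$; $\mathtt{lrec}\,v_r\,v_s\,\mathtt{nil}\to v_r$; $\mathtt{lrec}\,v_r\,v_s\,(v_h::v_t)\to v_s\,v_h\,v_t\,(\mathtt{lrec}\,v_r\,v_s\,v_t)$; $\twoheadrightarrow$ is its reflexive-transitive closure. Typing $\Gamma;\Delta\vdash t:\rho$ ($\Gamma$ maps variables to types, $\Delta$ maps continuation variables to arrow-free types): $x:\rho$ if $x:\rho\in\Gamma$; $():\mathtt{unit}$; $\mathtt{nil}:\mathtt{list}\,\sigma$; $(::):\sigma\to\mathtt{list}\,\sigma\to\mathtt{list}\,\sigma$; $\mathtt{lrec}:\rho\to(\sigma\to\mathtt{list}\,\sigma\to\rho\to\rho)\to\mathtt{list}\,\sigma\to\rho$; if $\Gamma,x:\sigma;\Delta\vdash t:\tau$ then $\Gamma;\Delta\vdash\lambda x.t:\sigma\to\tau$; if $\Gamma;\Delta\vdash t:\sigma\to\tau$ and $\Gamma;\Delta\vdash s:\sigma$ then $\Gamma;\Delta\vdash ts:\tau$; if $\Gamma;\Delta,\alpha:\psi\vdash t:\psi$ then $\Gamma;\Delta\vdash\mathtt{catch}\,\alpha\,t:\psi$; if $\Gamma;\Delta\vdash t:\psi$ and $\alpha:\psi\in\Delta$ then $\Gamma;\Delta\vdash\mathtt{throw}\,\alpha\,t:\tau$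 for any $\tau$. $\mathrm{SN}$ is the set of terms for which the lengths of all reduction sequences starting there are bounded. For a set of terms $S$, $L(S)$ is inductively defined by: $t\in L(S)$ if for all values $v,w$ with $t\twoheadrightarrow v::w$ we have $v\in S$ and $w\in L(S)$. Interpretation: $[\![\mathtt{unit}]\!]=\mathrm{SN}$, $[\![\mathtt{list}\,\sigma]\!]=\mathrm{SN}\cap L([\![\sigma]\!])$, $[\![\sigma\to\tau]\!]=\{t\mid \forall s\in[\![\sigma]\!],\ ts\in[\![\tau]\!]\}$. -}

module Defs where

open import Data.Nat using (ℕ; zero; suc; _≤_; _<?_)
open import Data.Fin using (Fin; fromℕ<)
open import Data.List using (List; []; _∷_; length; lookup)
open import Data.Product using (Σ; ∃; _×_; _,_)
open import Relation.Nullary using (yes; no)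

infixr 7 _⇒_
data Ty : Set where
  unit : Ty
  list : Ty → Ty
  _⇒_  : Ty → Ty → Ty

data ArrowFree : Ty → Set where
  af-unit : ArrowFree unit
  af-list : ∀ {σ} → ArrowFree σ → ArrowFree (list σ)

-- Terms, with de Bruijn indices both for ordinary variables (bound by λ)
-- and for continuation variables (bound by catch).

infixl 9 _·_
data Term : Set where
  var   : ℕ → Term
  ⟨⟩    : Term
  nil   : Term
  cons  : Term
  lrec  : Term
  ƛ     : Term → Term
  _·_   : Term → Term → Term
  catch : Term → Term          -- catch α t   (binds continuation index 0)
  throw : ℕ → Term → Term

_∷ₜ_ : Term → Term → Term
t ∷ₜ r = cons · t · r

ext : (ℕ → ℕ) → ℕ → ℕ
ext ρ zero    = zero
ext ρ (suc i) = suc (ρ i)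

ren : (ℕ → ℕ) → Term → Term
ren ρ (var i)     = var (ρ i)
ren ρ ⟨⟩          = ⟨⟩
ren ρ nil         = nil
ren ρ cons        = cons
ren ρ lrec        = lrec
ren ρ (ƛ t)       = ƛ (ren (ext ρ) t)
ren ρ (t · s)     = ren ρ t · ren ρ s
ren ρ (catch t)   = catch (ren ρ t)
ren ρ (throw a t) = throw a (ren ρ t)

cren : (ℕ → ℕ) → Term → Term
cren ρ (var i)     = var i
cren ρ ⟨⟩          = ⟨⟩
cren ρ nil         = nil
cren ρ cons        = cons
cren ρ lrec        = lrec
cren ρ (ƛ t)       = ƛ (cren ρ t)
cren ρ (t · s)     = cren ρ t · cren ρ s
cren ρ (catch t)   = catch (cren (ext ρ) t)
cren ρ (throw a t) = throw (ρ a) (cren ρ t)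

exts : (ℕ → Term) → ℕ → Term
exts σ zero    = var zero
exts σ (suc i) = ren suc (σ i)

sub : (ℕ → Term) → Term → Term
sub σ (var i)     = σ i
sub σ ⟨⟩          = ⟨⟩
sub σ nil         = nil
sub σ cons        = cons
sub σ lrec        = lrec
sub σ (ƛ t)       = ƛ (sub (exts σ) t)
sub σ (t · s)     = sub σ t · sub σ s
sub σ (catch t)   = catch (sub (λ i → cren suc (σ i)) t)
sub σ (throw a t) = throw a (sub σ t)

_[0:=_] : Term → Term → Term
t [0:= v ] = sub σ t
  where
  σ : ℕ → Term
  σ zero    = v
  σ (suc i) = var i

simSubst : ∀ {n} → (Fin n → Term) → ℕ → Term
simSubst {n} rs i with i <? n
... | yes p = rs (fromℕ< p)
... | no  _ = var i

data Value : Term → Set where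
  v-var   : ∀ i → Value (var i)
  v-unit  : Value ⟨⟩
  v-nil   : Value nil
  v-cons0 : Value cons
  v-cons1 : ∀ {v} → Value v → Value (cons · v)
  v-cons2 : ∀ {v w} → Value v → Value w → Value (cons · v · w)
  v-lrec0 : Value lrec
  v-lrec1 : ∀ {v} → Value v → Value (lrec · v)
  v-lrec2 : ∀ {v w} → Value v → Value w → Value (lrec · v · w)
  v-lam   : ∀ t → Value (ƛ t)

-- Side condition  α ∉ FCV(v)  is expressed by requiring the term to be of
-- the form  cren suc v  (the bound continuation index 0 does not occur).

infix 4 _⟶_
data _⟶_ : Term → Term → Set where
  β        : ∀ {t v} → Value v → ƛ t · v ⟶ t [0:= v ]
  -- E[throw α t] → throw α t,  E ::= □ t | v □ | throw β □
  throwL   : ∀ {a t s} → throw a t · s ⟶ throw a t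
  throwR   : ∀ {v a t} → Value v → v · throw a t ⟶ throw a t
  throwT   : ∀ {b a t} → throw b (throw a t) ⟶ throw a t
  catchSame : ∀ {t} → catch (throw zero t) ⟶ catch t
  catchOther : ∀ {b v} → Value v →
               catch (throw (suc b) (cren suc v)) ⟶ throw b v
  catchVal : ∀ {v} → Value v → catch (cren suc v) ⟶ v
  lrecNil  : ∀ {vr vs} → Value vr → Value vs →
             lrec · vr · vs · nil ⟶ vr
  lrecCons : ∀ {vr vs vh vt} → Value vr → Value vs → Value vh → Value vt →
             lrec · vr · vs · (vh ∷ₜ vt) ⟶ vs · vh · vt · (lrec · vr · vs · vt)
  ξ-ƛ      : ∀ {t t'} → t ⟶ t' → ƛ t ⟶ ƛ t'
  ξ-·₁     : ∀ {t t' s} → t ⟶ t' → t · s ⟶ t' · s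
  ξ-·₂     : ∀ {t s s'} → s ⟶ s' → t · s ⟶ t · s'
  ξ-catch  : ∀ {t t'} → t ⟶ t' → catch t ⟶ catch t'
  ξ-throw  : ∀ {a t t'} → t ⟶ t' → throw a t ⟶ throw a t'

data Steps : ℕ → Term → Term → Set where
  done : ∀ {t} → Steps zero t t
  step : ∀ {n t t' t''} → t ⟶ t' → Steps n t' t'' → Steps (suc n) t t''

infix 4 _↠_
_↠_ : Term → Term → Set
t ↠ t' = ∃ λ n → Steps n t t'

SN : Term → Set
SN t = Σ ℕ λ k → ∀ n t' → Steps n t t' → n ≤ k

data L (S : Term → Set) : Term → Set where
  mkL : ∀ {t} →
        (∀ v w → Value v → Value w → t ↠ (v ∷ₜ w) → S v × L S w) →
        L S t

⟦_⟧ : Ty → Term → Set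
⟦ unit ⟧    t = SN t
⟦ list σ ⟧  t = SN t × L ⟦ σ ⟧ t
⟦ σ ⇒ τ ⟧   t = ∀ s → ⟦ σ ⟧ s → ⟦ τ ⟧ (t · s)

infix 4 _∋_∶_
data _∋_∶_ : List Ty → ℕ → Ty → Set where
  here  : ∀ {Γ ρ} → (ρ ∷ Γ) ∋ zero ∶ ρ
  there : ∀ {Γ ρ ρ' i} → Γ ∋ i ∶ ρ → (ρ' ∷ Γ) ∋ suc i ∶ ρ

infix 4 _⨾_⊢_∶_
data _⨾_⊢_∶_ (Γ : List Ty) (Δ : List Ty) : Term → Ty → Set where
  ⊢var   : ∀ {i ρ} → Γ ∋ i ∶ ρ → Γ ⨾ Δ ⊢ var i ∶ ρ
  ⊢unit  : Γ ⨾ Δ ⊢ ⟨⟩ ∶ unit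
  ⊢nil   : ∀ {σ} → Γ ⨾ Δ ⊢ nil ∶ list σ
  ⊢cons  : ∀ {σ} → Γ ⨾ Δ ⊢ cons ∶ σ ⇒ list σ ⇒ list σ
  ⊢lrec  : ∀ {ρ σ} → Γ ⨾ Δ ⊢ lrec ∶ ρ ⇒ (σ ⇒ list σ ⇒ ρ ⇒ ρ) ⇒ list σ ⇒ ρ
  ⊢lam   : ∀ {σ τ t} → (σ ∷ Γ) ⨾ Δ ⊢ t ∶ τ → Γ ⨾ Δ ⊢ ƛ t ∶ σ ⇒ τ
  ⊢app   : ∀ {σ τ t s} → Γ ⨾ Δ ⊢ t ∶ σ ⇒ τ → Γ ⨾ Δ ⊢ s ∶ σ → Γ ⨾ Δ ⊢ t · s ∶ τ
  ⊢catch : ∀ {ψ t} → ArrowFree ψ → Γ ⨾ (ψ ∷ Δ) ⊢ t ∶ ψ → Γ ⨾ Δ ⊢ catch t ∶ ψ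
  ⊢throw : ∀ {ψ τ a t} → Γ ⨾ Δ ⊢ t ∶ ψ → Δ ∋ a ∶ ψ → Γ ⨾ Δ ⊢ throw a t ∶ τ

-- Tait–Girard reducibility.  Red τ is ⟦ τ ⟧ with SN replaced by accessibility of the reduction
-- relation (SNᵃ); the two notions agree because reduction is finitely branching, which is shown by
-- enumerating the reducts of a term.  Red enjoys the usual candidate properties (reducible terms are
-- SNᵃ, Red is closed under reduction, a neutral term whose reducts are all reducible is reducible),
-- thrown terms are reducible at every type, and each term former preserves reducibility, so the
-- fundamental lemma follows by induction on typing.  Two points are specific to catch: at an
-- arrow-free type ψ reducibility is just strong normalisation, so catch α t is reducible once t is;
-- and pushing a substitution under catch α weakens it by cren suc, which preserves reducibility
-- because on any given term cren suc agrees with a bijective renaming of continuation variables.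

module Submission where

open import Defs
open import Data.Empty using (⊥-elim)
open import Data.Fin using (Fin; fromℕ<)
open import Data.List using (List; []; _∷_; _++_; map; foldr; length; lookup)
open import Data.List.Relation.Unary.All using (All)
open import Data.List.Relation.Unary.Any using (Any; here; there)
import Data.List.Relation.Unary.Any as Any
open import Data.List.Relation.Unary.Any.Properties using (map⁺; ++⁺ˡ; ++⁺ʳ)
open import Data.Maybe using (Maybe; just; nothing)
import Data.Maybe as Maybe
open import Data.Maybe.Properties using (just-injective)
open import Data.Nat using (ℕ; zero; suc; _<_; _≤_; _⊔_; _<?_; z≤n; s≤s)
open import Data.Nat.Properties
  using (≤-trans; ≤-refl; ≤-pred; m≤m⊔n; m≤n⊔m; n≤1+n; <-cmp; <-irrefl; <⇒≱)
open import Data.Product using (Σ; Σ-syntax; _×_; _,_; proj₁; proj₂; swap; uncurry)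
open import Function using (_∘_; id; case_of_)
open import Induction.WellFounded using (Acc; acc)
open import Relation.Binary using (tri<; tri≈; tri>)
open import Relation.Binary.Construct.Closure.ReflexiveTransitive using (Star; ε; _◅_; _◅◅_; gmap)
open import Relation.Binary.PropositionalEquality
open import Relation.Nullary using (¬_; Dec; yes; no)
open import Relation.Nullary.Decidable using (map′; _×-dec_)

-- Renaming and substitution

infixr 5 _∷ₛ_
_∷ₛ_ : Term → (ℕ → Term) → ℕ → Term
(v ∷ₛ σ) zero    = v
(v ∷ₛ σ) (suc i) = σ i

ext-cong : ∀ {f g} → f ≗ g → ext f ≗ ext g
ext-cong e zero    = refl
ext-cong e (suc i) = cong suc (e i)

ren-cong : ∀ {f g} → f ≗ g → ren f ≗ ren g
ren-cong e (var i)     = cong var (e i)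
ren-cong e ⟨⟩          = refl
ren-cong e nil         = refl
ren-cong e cons        = refl
ren-cong e lrec        = refl
ren-cong e (ƛ t)       = cong ƛ (ren-cong (ext-cong e) t)
ren-cong e (t · s)     = cong₂ _·_ (ren-cong e t) (ren-cong e s)
ren-cong e (catch t)   = cong catch (ren-cong e t)
ren-cong e (throw a t) = cong (throw a) (ren-cong e t)

cren-cong : ∀ {f g} → f ≗ g → cren f ≗ cren g
cren-cong e (var i)     = refl
cren-cong e ⟨⟩          = refl
cren-cong e nil         = refl
cren-cong e cons        = refl
cren-cong e lrec        = refl
cren-cong e (ƛ t)       = cong ƛ (cren-cong e t)
cren-cong e (t · s)     = cong₂ _·_ (cren-cong e t) (cren-cong e s)
cren-cong e (catch t)   = cong catch (cren-cong (ext-cong e) t)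
cren-cong e (throw a t) = cong₂ throw (e a) (cren-cong e t)

exts-cong : ∀ {σ τ} → σ ≗ τ → exts σ ≗ exts τ
exts-cong e zero    = refl
exts-cong e (suc i) = cong (ren suc) (e i)

sub-cong : ∀ {σ τ} → σ ≗ τ → sub σ ≗ sub τ
sub-cong e (var i)     = e i
sub-cong e ⟨⟩          = refl
sub-cong e nil         = refl
sub-cong e cons        = refl
sub-cong e lrec        = refl
sub-cong e (ƛ t)       = cong ƛ (sub-cong (exts-cong e) t)
sub-cong e (t · s)     = cong₂ _·_ (sub-cong e t) (sub-cong e s)
sub-cong e (catch t)   = cong catch (sub-cong (cong (cren suc) ∘ e) t)
sub-cong e (throw a t) = cong (throw a) (sub-cong e t)

ext-∘ : ∀ f g → ext f ∘ ext g ≗ ext (f ∘ g)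
ext-∘ f g zero    = refl
ext-∘ f g (suc i) = refl

cren-cren : ∀ f g t → cren f (cren g t) ≡ cren (f ∘ g) t
cren-cren f g (var i)     = refl
cren-cren f g ⟨⟩          = refl
cren-cren f g nil         = refl
cren-cren f g cons        = refl
cren-cren f g lrec        = refl
cren-cren f g (ƛ t)       = cong ƛ (cren-cren f g t)
cren-cren f g (t · s)     = cong₂ _·_ (cren-cren f g t) (cren-cren f g s)
cren-cren f g (catch t)   =
  cong catch (trans (cren-cren (ext f) (ext g) t) (cren-cong (ext-∘ f g) t))
cren-cren f g (throw a t) = cong (throw (f (g a))) (cren-cren f g t)

ren-ren : ∀ f g t → ren f (ren g t) ≡ ren (f ∘ g) t
ren-ren f g (var i)     = refl
ren-ren f g ⟨⟩          = refl
ren-ren f g nil         = refl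
ren-ren f g cons        = refl
ren-ren f g lrec        = refl
ren-ren f g (ƛ t)       =
  cong ƛ (trans (ren-ren (ext f) (ext g) t) (ren-cong (ext-∘ f g) t))
ren-ren f g (t · s)     = cong₂ _·_ (ren-ren f g t) (ren-ren f g s)
ren-ren f g (catch t)   = cong catch (ren-ren f g t)
ren-ren f g (throw a t) = cong (throw a) (ren-ren f g t)

cren-id : ∀ {f} → f ≗ id → ∀ t → cren f t ≡ t
cren-id e (var i)     = refl
cren-id e ⟨⟩          = refl
cren-id e nil         = refl
cren-id e cons        = refl
cren-id e lrec        = refl
cren-id e (ƛ t)       = cong ƛ (cren-id e t)
cren-id e (t · s)     = cong₂ _·_ (cren-id e t) (cren-id e s)
cren-id e (catch t)   = cong catch (cren-id (λ { zero → refl ; (suc i) → cong suc (e i) }) t)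
cren-id e (throw a t) = cong₂ throw (e a) (cren-id e t)

ren-cren : ∀ f g t → ren f (cren g t) ≡ cren g (ren f t)
ren-cren f g (var i)     = refl
ren-cren f g ⟨⟩          = refl
ren-cren f g nil         = refl
ren-cren f g cons        = refl
ren-cren f g lrec        = refl
ren-cren f g (ƛ t)       = cong ƛ (ren-cren (ext f) g t)
ren-cren f g (t · s)     = cong₂ _·_ (ren-cren f g t) (ren-cren f g s)
ren-cren f g (catch t)   = cong catch (ren-cren f (ext g) t)
ren-cren f g (throw a t) = cong (throw (g a)) (ren-cren f g t)

cren-sub : ∀ g σ t → cren g (sub σ t) ≡ sub (cren g ∘ σ) (cren g t)
cren-sub g σ (var i)     = refl
cren-sub g σ ⟨⟩          = refl
cren-sub g σ nil         = refl
cren-sub g σ cons        = refl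
cren-sub g σ lrec        = refl
cren-sub g σ (ƛ t)       = cong ƛ (trans (cren-sub g (exts σ) t) (sub-cong pw (cren g t)))
  where
  pw : cren g ∘ exts σ ≗ exts (cren g ∘ σ)
  pw zero    = refl
  pw (suc i) = sym (ren-cren suc g (σ i))
cren-sub g σ (t · s)     = cong₂ _·_ (cren-sub g σ t) (cren-sub g σ s)
cren-sub g σ (catch t)   =
  cong catch (trans (cren-sub (ext g) (cren suc ∘ σ) t) (sub-cong pw (cren (ext g) t)))
  where
  pw : cren (ext g) ∘ cren suc ∘ σ ≗ cren suc ∘ cren g ∘ σ
  pw i = trans (cren-cren (ext g) suc (σ i)) (sym (cren-cren suc g (σ i)))
cren-sub g σ (throw a t) = cong (throw (g a)) (cren-sub g σ t)

ren-sub : ∀ f σ t → ren f (sub σ t) ≡ sub (ren f ∘ σ) t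
ren-sub f σ (var i)     = refl
ren-sub f σ ⟨⟩          = refl
ren-sub f σ nil         = refl
ren-sub f σ cons        = refl
ren-sub f σ lrec        = refl
ren-sub f σ (ƛ t)       = cong ƛ (trans (ren-sub (ext f) (exts σ) t) (sub-cong pw t))
  where
  pw : ren (ext f) ∘ exts σ ≗ exts (ren f ∘ σ)
  pw zero    = refl
  pw (suc i) = trans (ren-ren (ext f) suc (σ i)) (sym (ren-ren suc f (σ i)))
ren-sub f σ (t · s)     = cong₂ _·_ (ren-sub f σ t) (ren-sub f σ s)
ren-sub f σ (catch t)   =
  cong catch (trans (ren-sub f (cren suc ∘ σ) t) (sub-cong (ren-cren f suc ∘ σ) t))
ren-sub f σ (throw a t) = cong (throw a) (ren-sub f σ t)

sub-ren : ∀ σ f t → sub σ (ren f t) ≡ sub (σ ∘ f) t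
sub-ren σ f (var i)     = refl
sub-ren σ f ⟨⟩          = refl
sub-ren σ f nil         = refl
sub-ren σ f cons        = refl
sub-ren σ f lrec        = refl
sub-ren σ f (ƛ t)       =
  cong ƛ (trans (sub-ren (exts σ) (ext f) t) (sub-cong (λ { zero → refl ; (suc i) → refl }) t))
sub-ren σ f (t · s)     = cong₂ _·_ (sub-ren σ f t) (sub-ren σ f s)
sub-ren σ f (catch t)   = cong catch (sub-ren (cren suc ∘ σ) f t)
sub-ren σ f (throw a t) = cong (throw a) (sub-ren σ f t)

sub-sub : ∀ τ σ t → sub τ (sub σ t) ≡ sub (sub τ ∘ σ) t
sub-sub τ σ (var i)     = refl
sub-sub τ σ ⟨⟩          = refl
sub-sub τ σ nil         = refl
sub-sub τ σ cons        = refl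
sub-sub τ σ lrec        = refl
sub-sub τ σ (ƛ t)       = cong ƛ (trans (sub-sub (exts τ) (exts σ) t) (sub-cong pw t))
  where
  pw : sub (exts τ) ∘ exts σ ≗ exts (sub τ ∘ σ)
  pw zero    = refl
  pw (suc i) = trans (sub-ren (exts τ) suc (σ i)) (sym (ren-sub suc τ (σ i)))
sub-sub τ σ (t · s)     = cong₂ _·_ (sub-sub τ σ t) (sub-sub τ σ s)
sub-sub τ σ (catch t)   =
  cong catch (trans (sub-sub (cren suc ∘ τ) (cren suc ∘ σ) t)
                    (sub-cong (λ i → sym (cren-sub suc τ (σ i))) t))
sub-sub τ σ (throw a t) = cong (throw a) (sub-sub τ σ t)

sub-var : ∀ {σ} → σ ≗ var → ∀ t → sub σ t ≡ t
sub-var e (var i)     = e i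
sub-var e ⟨⟩          = refl
sub-var e nil         = refl
sub-var e cons        = refl
sub-var e lrec        = refl
sub-var e (ƛ t)       = cong ƛ (sub-var (λ { zero → refl ; (suc i) → cong (ren suc) (e i) }) t)
sub-var e (t · s)     = cong₂ _·_ (sub-var e t) (sub-var e s)
sub-var e (catch t)   = cong catch (sub-var (cong (cren suc) ∘ e) t)
sub-var e (throw a t) = cong (throw a) (sub-var e t)

[0:=]-sub : ∀ t v → t [0:= v ] ≡ sub (v ∷ₛ var) t
[0:=]-sub t v = sub-cong (λ { zero → refl ; (suc i) → refl }) t

sub-exts-[0:=] : ∀ σ t v → sub (exts σ) t [0:= v ] ≡ sub (v ∷ₛ σ) t
sub-exts-[0:=] σ t v = begin
  sub (exts σ) t [0:= v ]            ≡⟨ [0:=]-sub (sub (exts σ) t) v ⟩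
  sub (v ∷ₛ var) (sub (exts σ) t)    ≡⟨ sub-sub (v ∷ₛ var) (exts σ) t ⟩
  sub (sub (v ∷ₛ var) ∘ exts σ) t    ≡⟨ sub-cong pw t ⟩
  sub (v ∷ₛ σ) t                     ∎
  where
  open ≡-Reasoning
  pw : sub (v ∷ₛ var) ∘ exts σ ≗ v ∷ₛ σ
  pw zero    = refl
  pw (suc i) = trans (sub-ren (v ∷ₛ var) suc (σ i)) (sub-var (λ _ → refl) (σ i))

sub-[0:=] : ∀ σ t v → sub (exts σ) t [0:= sub σ v ] ≡ sub σ (t [0:= v ])
sub-[0:=] σ t v = begin
  sub (exts σ) t [0:= sub σ v ]      ≡⟨ sub-exts-[0:=] σ t (sub σ v) ⟩
  sub (sub σ v ∷ₛ σ) t               ≡⟨ sub-cong (λ { zero → refl ; (suc i) → refl }) t ⟩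
  sub (sub σ ∘ (v ∷ₛ var)) t         ≡⟨ sub-sub σ (v ∷ₛ var) t ⟨
  sub σ (sub (v ∷ₛ var) t)           ≡⟨ cong (sub σ) ([0:=]-sub t v) ⟨
  sub σ (t [0:= v ])                 ∎
  where open ≡-Reasoning

cren-[0:=] : ∀ f t v → cren f t [0:= cren f v ] ≡ cren f (t [0:= v ])
cren-[0:=] f t v = begin
  cren f t [0:= cren f v ]           ≡⟨ [0:=]-sub (cren f t) (cren f v) ⟩
  sub (cren f v ∷ₛ var) (cren f t)   ≡⟨ sub-cong (λ { zero → refl ; (suc i) → refl }) (cren f t) ⟨
  sub (cren f ∘ (v ∷ₛ var)) (cren f t) ≡⟨ cren-sub f (v ∷ₛ var) t ⟨
  cren f (sub (v ∷ₛ var) t)          ≡⟨ cong (cren f) ([0:=]-sub t v) ⟨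
  cren f (t [0:= v ])                ∎
  where open ≡-Reasoning

Value-ren : ∀ f {v} → Value v → Value (ren f v)
Value-ren f (v-var i)     = v-var _
Value-ren f v-unit        = v-unit
Value-ren f v-nil         = v-nil
Value-ren f v-cons0       = v-cons0
Value-ren f (v-cons1 x)   = v-cons1 (Value-ren f x)
Value-ren f (v-cons2 x y) = v-cons2 (Value-ren f x) (Value-ren f y)
Value-ren f v-lrec0       = v-lrec0
Value-ren f (v-lrec1 x)   = v-lrec1 (Value-ren f x)
Value-ren f (v-lrec2 x y) = v-lrec2 (Value-ren f x) (Value-ren f y)
Value-ren f (v-lam t)     = v-lam _

Value-cren : ∀ f {v} → Value v → Value (cren f v)
Value-cren f (v-var i)     = v-var _
Value-cren f v-unit        = v-unit
Value-cren f v-nil         = v-nil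
Value-cren f v-cons0       = v-cons0
Value-cren f (v-cons1 x)   = v-cons1 (Value-cren f x)
Value-cren f (v-cons2 x y) = v-cons2 (Value-cren f x) (Value-cren f y)
Value-cren f v-lrec0       = v-lrec0
Value-cren f (v-lrec1 x)   = v-lrec1 (Value-cren f x)
Value-cren f (v-lrec2 x y) = v-lrec2 (Value-cren f x) (Value-cren f y)
Value-cren f (v-lam t)     = v-lam _

Value-sub : ∀ {σ} → (∀ i → Value (σ i)) → ∀ {v} → Value v → Value (sub σ v)
Value-sub h (v-var i)     = h i
Value-sub h v-unit        = v-unit
Value-sub h v-nil         = v-nil
Value-sub h v-cons0       = v-cons0
Value-sub h (v-cons1 x)   = v-cons1 (Value-sub h x)
Value-sub h (v-cons2 x y) = v-cons2 (Value-sub h x) (Value-sub h y)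
Value-sub h v-lrec0       = v-lrec0
Value-sub h (v-lrec1 x)   = v-lrec1 (Value-sub h x)
Value-sub h (v-lrec2 x y) = v-lrec2 (Value-sub h x) (Value-sub h y)
Value-sub h (v-lam t)     = v-lam _

Value-∷ₛ-var : ∀ {v} → Value v → ∀ i → Value ((v ∷ₛ var) i)
Value-∷ₛ-var vv zero    = vv
Value-∷ₛ-var vv (suc i) = v-var i

Value-exts : ∀ {σ} → (∀ i → Value (σ i)) → ∀ i → Value (exts σ i)
Value-exts h zero    = v-var zero
Value-exts h (suc i) = Value-ren suc (h i)

sub-⟶ : ∀ {σ} → (∀ i → Value (σ i)) → ∀ {t t'} → t ⟶ t' → sub σ t ⟶ sub σ t'
sub-⟶ {σ} h (β {t} {v} vv)         = subst₂ _⟶_ refl (sub-[0:=] σ t v) (β (Value-sub h vv))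
sub-⟶ h throwL                     = throwL
sub-⟶ h (throwR vv)                = throwR (Value-sub h vv)
sub-⟶ h throwT                     = throwT
sub-⟶ h catchSame                  = catchSame
sub-⟶ {σ} h (catchOther {b} {v} vv) =
  subst₂ _⟶_ (cong (catch ∘ throw (suc b)) (cren-sub suc σ v)) refl (catchOther (Value-sub h vv))
sub-⟶ {σ} h (catchVal {v} vv)      =
  subst₂ _⟶_ (cong catch (cren-sub suc σ v)) refl (catchVal (Value-sub h vv))
sub-⟶ h (lrecNil a b)              = lrecNil (Value-sub h a) (Value-sub h b)
sub-⟶ h (lrecCons a b c d)         = lrecCons (Value-sub h a) (Value-sub h b) (Value-sub h c) (Value-sub h d)
sub-⟶ h (ξ-ƛ r)                    = ξ-ƛ (sub-⟶ (Value-exts h) r)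
sub-⟶ h (ξ-·₁ r)                   = ξ-·₁ (sub-⟶ h r)
sub-⟶ h (ξ-·₂ r)                   = ξ-·₂ (sub-⟶ h r)
sub-⟶ h (ξ-catch r)                = ξ-catch (sub-⟶ (Value-cren suc ∘ h) r)
sub-⟶ h (ξ-throw r)                = ξ-throw (sub-⟶ h r)

cren-suc-comm : ∀ f v → cren suc (cren f v) ≡ cren (ext f) (cren suc v)
cren-suc-comm f v = trans (cren-cren suc f v) (sym (cren-cren (ext f) suc v))

cren-⟶ : ∀ f {t t'} → t ⟶ t' → cren f t ⟶ cren f t'
cren-⟶ f (β {t} {v} vv)          = subst₂ _⟶_ refl (cren-[0:=] f t v) (β (Value-cren f vv))
cren-⟶ f throwL                  = throwL
cren-⟶ f (throwR vv)             = throwR (Value-cren f vv)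
cren-⟶ f throwT                  = throwT
cren-⟶ f catchSame               = catchSame
cren-⟶ f (catchOther {b} {v} vv) =
  subst₂ _⟶_ (cong (catch ∘ throw (suc (f b))) (cren-suc-comm f v)) refl (catchOther (Value-cren f vv))
cren-⟶ f (catchVal {v} vv)       =
  subst₂ _⟶_ (cong catch (cren-suc-comm f v)) refl (catchVal (Value-cren f vv))
cren-⟶ f (lrecNil a b)           = lrecNil (Value-cren f a) (Value-cren f b)
cren-⟶ f (lrecCons a b c d)      =
  lrecCons (Value-cren f a) (Value-cren f b) (Value-cren f c) (Value-cren f d)
cren-⟶ f (ξ-ƛ r)                 = ξ-ƛ (cren-⟶ f r)
cren-⟶ f (ξ-·₁ r)                = ξ-·₁ (cren-⟶ f r)
cren-⟶ f (ξ-·₂ r)                = ξ-·₂ (cren-⟶ f r)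
cren-⟶ f (ξ-catch r)             = ξ-catch (cren-⟶ (ext f) r)
cren-⟶ f (ξ-throw r)             = ξ-throw (cren-⟶ f r)

[0:=]-⟶ : ∀ {u u' v} → Value v → u ⟶ u' → u [0:= v ] ⟶ u' [0:= v ]
[0:=]-⟶ {u} {u'} {v} vv r =
  subst₂ _⟶_ (sym ([0:=]-sub u v)) (sym ([0:=]-sub u' v))
    (sub-⟶ (Value-∷ₛ-var vv) r)

-- Reduction is finitely branching

value? : ∀ t → Dec (Value t)
value-app? : ∀ t s → Dec (Value (t · s))
value? (var i)     = yes (v-var i)
value? ⟨⟩          = yes v-unit
value? nil         = yes v-nil
value? cons        = yes v-cons0
value? lrec        = yes v-lrec0
value? (ƛ t)       = yes (v-lam t)
value? (t · s)     = value-app? t s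
value? (catch t)   = no λ ()
value? (throw a t) = no λ ()
value-app? cons s            = map′ v-cons1 (λ { (v-cons1 p) → p }) (value? s)
value-app? lrec s            = map′ v-lrec1 (λ { (v-lrec1 p) → p }) (value? s)
value-app? (cons · v) s      =
  map′ (uncurry v-cons2) (λ { (v-cons2 p q) → p , q }) (value? v ×-dec value? s)
value-app? (lrec · v) s      =
  map′ (uncurry v-lrec2) (λ { (v-lrec2 p q) → p , q }) (value? v ×-dec value? s)
value-app? (var i) s         = no λ ()
value-app? ⟨⟩ s              = no λ ()
value-app? nil s             = no λ ()
value-app? (ƛ t) s           = no λ ()
value-app? (catch t) s       = no λ ()
value-app? (throw a t) s     = no λ ()
value-app? (var i · u) s     = no λ ()
value-app? (⟨⟩ · u) s        = no λ ()
value-app? (nil · u) s       = no λ ()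
value-app? (ƛ t · u) s       = no λ ()
value-app? (catch t · u) s   = no λ ()
value-app? (throw a t · u) s = no λ ()
value-app? (t · r · u) s     = no λ ()

-- `cren (shiftFrom k)` shifts the free continuation variables ≥ k; `unshift k` is its partial inverse.
shiftFrom : ℕ → ℕ → ℕ
shiftFrom zero    = suc
shiftFrom (suc k) = ext (shiftFrom k)

unshiftVar : ℕ → ℕ → Maybe ℕ
unshiftVar zero    zero    = nothing
unshiftVar zero    (suc a) = just a
unshiftVar (suc k) zero    = just zero
unshiftVar (suc k) (suc a) = Maybe.map suc (unshiftVar k a)

unshift : ℕ → Term → Maybe Term
unshift k (var i)     = just (var i)
unshift k ⟨⟩          = just ⟨⟩
unshift k nil         = just nil
unshift k cons        = just cons
unshift k lrec        = just lrec
unshift k (ƛ t)       = Maybe.map ƛ (unshift k t)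
unshift k (t · s)     = Maybe.zipWith _·_ (unshift k t) (unshift k s)
unshift k (catch t)   = Maybe.map catch (unshift (suc k) t)
unshift k (throw a t) = Maybe.zipWith throw (unshiftVar k a) (unshift k t)

unshiftVar-shiftFrom : ∀ k a → unshiftVar k (shiftFrom k a) ≡ just a
unshiftVar-shiftFrom zero    a       = refl
unshiftVar-shiftFrom (suc k) zero    = refl
unshiftVar-shiftFrom (suc k) (suc a) rewrite unshiftVar-shiftFrom k a = refl

unshiftVar-sound : ∀ k a {b} → unshiftVar k a ≡ just b → a ≡ shiftFrom k b
unshiftVar-sound zero    (suc a) refl = refl
unshiftVar-sound (suc k) zero    refl = refl
unshiftVar-sound (suc k) (suc a) eq with unshiftVar k a in e
unshiftVar-sound (suc k) (suc a) refl | just b = cong suc (unshiftVar-sound k a e)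

unshift-shift : ∀ k t → unshift k (cren (shiftFrom k) t) ≡ just t
unshift-shift k (var i)     = refl
unshift-shift k ⟨⟩          = refl
unshift-shift k nil         = refl
unshift-shift k cons        = refl
unshift-shift k lrec        = refl
unshift-shift k (ƛ t)       rewrite unshift-shift k t = refl
unshift-shift k (t · s)     rewrite unshift-shift k t | unshift-shift k s = refl
unshift-shift k (catch t)   rewrite unshift-shift (suc k) t = refl
unshift-shift k (throw a t) rewrite unshiftVar-shiftFrom k a | unshift-shift k t = refl

unshift-sound : ∀ k t {v} → unshift k t ≡ just v → t ≡ cren (shiftFrom k) v
unshift-sound k (var i) refl = refl
unshift-sound k ⟨⟩      refl = refl
unshift-sound k nil     refl = refl
unshift-sound k cons    refl = refl
unshift-sound k lrec    refl = refl
unshift-sound k (ƛ t) eq with unshift k t in e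
unshift-sound k (ƛ t) refl | just _ = cong ƛ (unshift-sound k t e)
unshift-sound k (t · s) eq with unshift k t in e₁ | unshift k s in e₂
unshift-sound k (t · s) refl | just _ | just _ =
  cong₂ _·_ (unshift-sound k t e₁) (unshift-sound k s e₂)
unshift-sound k (catch t) eq with unshift (suc k) t in e
unshift-sound k (catch t) refl | just _ = cong catch (unshift-sound (suc k) t e)
unshift-sound k (throw a t) eq with unshiftVar k a in e₁ | unshift k t in e₂
unshift-sound k (throw a t) refl | just _ | just _ =
  cong₂ throw (unshiftVar-sound k a e₁) (unshift-sound k t e₂)

cren-suc-injective : ∀ {v w} → cren suc v ≡ cren suc w → v ≡ w
cren-suc-injective {v} {w} eq =
  just-injective (trans (sym (unshift-shift 0 v)) (trans (cong (unshift 0) eq) (unshift-shift 0 w)))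

-- The side condition α ∉ FCV(v) of the catch rules, in the encoding of Defs.
WeakenedValue : Term → Set
WeakenedValue t = Σ[ v ∈ Term ] Value v × cren suc v ≡ t

weakenedValue? : ∀ t → Dec (WeakenedValue t)
weakenedValue? t with unshift 0 t in e
... | nothing = no λ { (v , _ , refl) → case trans (sym e) (unshift-shift 0 v) of λ () }
... | just v  = map′ (λ p → v , p , sym (unshift-sound 0 t e))
                     (λ { (w , p , refl) → subst Value (just-injective (trans (sym (unshift-shift 0 w)) e)) p })
                     (value? v)

Reducts : Term → Set
Reducts t = List (Σ Term (t ⟶_))

infix 4 _∈ᵣ_
_∈ᵣ_ : ∀ {t} → Term → Reducts t → Set
u ∈ᵣ rs = Any ((_≡ u) ∘ proj₁) rs

whenever : ∀ {P : Set} {t} → Dec P → (P → Σ Term (t ⟶_)) → Reducts t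
whenever (yes p) f = f p ∷ []
whenever (no _)  f = []

∈-whenever : ∀ {P : Set} {t u} (d : Dec P) (f : P → Σ Term (t ⟶_)) →
             P → (∀ p → proj₁ (f p) ≡ u) → u ∈ᵣ whenever d f
∈-whenever (yes p) f _ eq = here (eq p)
∈-whenever (no ¬p) f p _  = ⊥-elim (¬p p)

under : ∀ {t} (F : Term → Term) → (∀ {u} → t ⟶ u → F t ⟶ F u) → Reducts t → Reducts (F t)
under F ξ = map λ (u , r) → F u , ξ r

∈-under : ∀ {t u} {rs : Reducts t} (F : Term → Term) (ξ : ∀ {u} → t ⟶ u → F t ⟶ F u) →
          u ∈ᵣ rs → F u ∈ᵣ under F ξ rs
∈-under F ξ = map⁺ ∘ Any.map (cong F)

βᶜ : ∀ t s → Reducts (t · s)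
βᶜ (ƛ b) s = whenever (value? s) λ p → b [0:= s ] , β p
βᶜ _     _ = []

throwLᶜ : ∀ t s → Reducts (t · s)
throwLᶜ (throw a x) s = (throw a x , throwL) ∷ []
throwLᶜ _           _ = []

throwRᶜ : ∀ t s → Reducts (t · s)
throwRᶜ t (throw a x) = whenever (value? t) λ p → throw a x , throwR p
throwRᶜ _ _           = []

lrecᶜ : ∀ t s → Reducts (t · s)
lrecᶜ (lrec · vr · vs) nil              =
  whenever (value? vr ×-dec value? vs) λ (p , q) → vr , lrecNil p q
lrecᶜ (lrec · vr · vs) (cons · vh · vt) =
  whenever (value? vr ×-dec value? vs ×-dec value? vh ×-dec value? vt)
    λ (p , q , r , u) → vs · vh · vt · (lrec · vr · vs · vt) , lrecCons p q r u
lrecᶜ _ _ = []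

catchThrowᶜ : ∀ t → Reducts (catch t)
catchThrowᶜ (throw zero x)    = (catch x , catchSame) ∷ []
catchThrowᶜ (throw (suc b) x) = whenever (weakenedValue? x)
  λ (v , p , eq) → throw b v , subst (λ x → catch (throw (suc b) x) ⟶ throw b v) eq (catchOther p)
catchThrowᶜ _                 = []

catchValᶜ : ∀ t → Reducts (catch t)
catchValᶜ t = whenever (weakenedValue? t)
  λ (v , p , eq) → v , subst (λ t → catch t ⟶ v) eq (catchVal p)

throwᶜ : ∀ a t → Reducts (throw a t)
throwᶜ b (throw a x) = (throw a x , throwT) ∷ []
throwᶜ _ _           = []

contractions : ∀ t → Reducts t
contractions (t · s)     = βᶜ t s ++ throwLᶜ t s ++ throwRᶜ t s ++ lrecᶜ t s
contractions (catch t)   = catchThrowᶜ t ++ catchValᶜ t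
contractions (throw a t) = throwᶜ a t
contractions _           = []

reducts : ∀ t → Reducts t
congruences : ∀ t → Reducts t
reducts t = contractions t ++ congruences t
congruences (ƛ t)       = under ƛ ξ-ƛ (reducts t)
congruences (t · s)     = under (_· s) ξ-·₁ (reducts t) ++ under (t ·_) ξ-·₂ (reducts s)
congruences (catch t)   = under catch ξ-catch (reducts t)
congruences (throw a t) = under (throw a) ξ-throw (reducts t)
congruences _           = []

module _ {t s u : Term} where
  ∈-βᶜ : u ∈ᵣ βᶜ t s → u ∈ᵣ contractions (t · s)
  ∈-βᶜ = ++⁺ˡ

  ∈-throwLᶜ : u ∈ᵣ throwLᶜ t s → u ∈ᵣ contractions (t · s)
  ∈-throwLᶜ = ++⁺ʳ (βᶜ t s) ∘ ++⁺ˡ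

  ∈-throwRᶜ : u ∈ᵣ throwRᶜ t s → u ∈ᵣ contractions (t · s)
  ∈-throwRᶜ = ++⁺ʳ (βᶜ t s) ∘ ++⁺ʳ (throwLᶜ t s) ∘ ++⁺ˡ

  ∈-lrecᶜ : u ∈ᵣ lrecᶜ t s → u ∈ᵣ contractions (t · s)
  ∈-lrecᶜ = ++⁺ʳ (βᶜ t s) ∘ ++⁺ʳ (throwLᶜ t s) ∘ ++⁺ʳ (throwRᶜ t s)

  ∈-·₁ : u ∈ᵣ reducts t → u · s ∈ᵣ congruences (t · s)
  ∈-·₁ = ++⁺ˡ ∘ ∈-under (_· s) ξ-·₁

  ∈-·₂ : u ∈ᵣ reducts s → t · u ∈ᵣ congruences (t · s)
  ∈-·₂ = ++⁺ʳ (under (_· s) ξ-·₁ (reducts t)) ∘ ∈-under (t ·_) ξ-·₂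

module _ {t u : Term} where
  ∈-catchThrowᶜ : u ∈ᵣ catchThrowᶜ t → u ∈ᵣ contractions (catch t)
  ∈-catchThrowᶜ = ++⁺ˡ

  ∈-catchValᶜ : u ∈ᵣ catchValᶜ t → u ∈ᵣ contractions (catch t)
  ∈-catchValᶜ = ++⁺ʳ (catchThrowᶜ t)

  ∈-contractions : u ∈ᵣ contractions t → u ∈ᵣ reducts t
  ∈-contractions = ++⁺ˡ

  ∈-congruences : u ∈ᵣ congruences t → u ∈ᵣ reducts t
  ∈-congruences = ++⁺ʳ (contractions t)

reducts-complete : ∀ {t u} → t ⟶ u → u ∈ᵣ reducts t
reducts-complete (ξ-ƛ r)     = ∈-congruences (∈-under ƛ ξ-ƛ (reducts-complete r))
reducts-complete (ξ-·₁ r)    = ∈-congruences (∈-·₁ (reducts-complete r))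
reducts-complete (ξ-·₂ r)    = ∈-congruences (∈-·₂ (reducts-complete r))
reducts-complete (ξ-catch r) = ∈-congruences (∈-under catch ξ-catch (reducts-complete r))
reducts-complete (ξ-throw r) = ∈-congruences (∈-under (throw _) ξ-throw (reducts-complete r))
reducts-complete {ƛ b · v} (β vv) =
  ∈-contractions (∈-βᶜ (∈-whenever (value? v) _ vv λ _ → refl))
reducts-complete throwL = ∈-contractions (∈-throwLᶜ (here refl))
reducts-complete {t · _} (throwR vt) =
  ∈-contractions (∈-throwRᶜ (∈-whenever (value? t) _ vt λ _ → refl))
reducts-complete throwT = ∈-contractions (here refl)
reducts-complete catchSame = ∈-contractions (∈-catchThrowᶜ (here refl))
reducts-complete (catchOther {b} {v} vv) =
  ∈-contractions (∈-catchThrowᶜ (∈-whenever (weakenedValue? (cren suc v)) _ (v , vv , refl)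
    λ (_ , _ , eq) → cong (throw b) (cren-suc-injective eq)))
reducts-complete (catchVal {v} vv) =
  ∈-contractions (∈-catchValᶜ (∈-whenever (weakenedValue? (cren suc v)) _ (v , vv , refl)
    λ (_ , _ , eq) → cren-suc-injective eq))
reducts-complete {lrec · vr · vs · _} (lrecNil p q) =
  ∈-contractions (∈-lrecᶜ (∈-whenever (value? vr ×-dec value? vs) _ (p , q) λ _ → refl))
reducts-complete {lrec · vr · vs · (_ · vh · vt)} (lrecCons p q r u) =
  ∈-contractions (∈-lrecᶜ (∈-whenever (value? vr ×-dec value? vs ×-dec value? vh ×-dec value? vt) _
    (p , q , r , u) λ _ → refl))

-- Strong normalisation

infix 4 _⟶*_ _⟵_
_⟶*_ : Term → Term → Set
_⟶*_ = Star _⟶_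

↠⇒⟶* : ∀ {t u} → t ↠ u → t ⟶* u
↠⇒⟶* (_ , done)     = ε
↠⇒⟶* (_ , step r s) = r ◅ ↠⇒⟶* (_ , s)

⟶*⇒↠ : ∀ {t u} → t ⟶* u → t ↠ u
⟶*⇒↠ ε       = _ , done
⟶*⇒↠ (r ◅ p) = let n , s = ⟶*⇒↠ p in suc n , step r s

_⟵_ : Term → Term → Set
u ⟵ t = t ⟶ u

SNᵃ : Term → Set
SNᵃ = Acc _⟵_

SN⇒SNᵃ : ∀ {t} → SN t → SNᵃ t
SN⇒SNᵃ (k , bounded) = go k bounded
  where
  go : ∀ k {t} → (∀ n u → Steps n t u → n ≤ k) → SNᵃ t
  go zero    bounded = acc λ r → case bounded 1 _ (step r done) of λ ()
  go (suc k) bounded = acc λ r → go k λ n u s → ≤-pred (bounded (suc n) u (step r s))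

-- Reduction is finitely branching, so the reduction tree of an accessible term has a finite height.
height : ∀ t → SNᵃ t → ℕ
height t (acc h) = suc (foldr (λ (u , r) m → height u (h r) ⊔ m) 0 (reducts t))

height-reduct : ∀ {t} (h : ∀ {u} → t ⟶ u → SNᵃ u) (rs : Reducts t) {u} → u ∈ᵣ rs →
                Σ (t ⟶ u) λ r → height u (h r) ≤ foldr (λ (u , r) m → height u (h r) ⊔ m) 0 rs
height-reduct h ((u , r) ∷ rs) (here refl) = r , m≤m⊔n _ _
height-reduct h (_ ∷ rs)       (there i)   =
  let r , le = height-reduct h rs i in r , ≤-trans le (m≤n⊔m _ _)

height-bounds-Steps : ∀ {t} (sn : SNᵃ t) {n u} → Steps n t u → n ≤ height t sn
height-bounds-Steps sn          done         = z≤n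
height-bounds-Steps {t} (acc h) (step r₀ s) =
  let r , le = height-reduct h (reducts t) (reducts-complete r₀) in
  s≤s (≤-trans (height-bounds-Steps (h r) s) le)

SNᵃ⇒SN : ∀ {t} → SNᵃ t → SN t
SNᵃ⇒SN {t} sn = height t sn , λ _ _ → height-bounds-Steps sn

SNᵃ-⟶* : ∀ {t u} → SNᵃ t → t ⟶* u → SNᵃ u
SNᵃ-⟶* sn      ε       = sn
SNᵃ-⟶* (acc h) (r ◅ p) = SNᵃ-⟶* (h r) p

SNᵃ-preimage : (F : Term → Term) → (∀ {t u} → t ⟶ u → F t ⟶ F u) → ∀ {t} → SNᵃ (F t) → SNᵃ t
SNᵃ-preimage F F-⟶ (acc h) = acc λ r → SNᵃ-preimage F F-⟶ (h (F-⟶ r))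

SNᵃ-cren⁻ : ∀ f {t} → SNᵃ (cren f t) → SNᵃ t
SNᵃ-cren⁻ f = SNᵃ-preimage (cren f) (cren-⟶ f)

SNᵃ-[0:=]⁻ : ∀ {u v} → Value v → SNᵃ (u [0:= v ]) → SNᵃ u
SNᵃ-[0:=]⁻ {u} {v} vv sn =
  SNᵃ-preimage (sub (v ∷ₛ var)) (sub-⟶ (Value-∷ₛ-var vv)) (subst SNᵃ ([0:=]-sub u v) sn)

SNᵃ-·ˡ : ∀ {t s} → SNᵃ (t · s) → SNᵃ t
SNᵃ-·ˡ {s = s} = SNᵃ-preimage (_· s) ξ-·₁

SNᵃ-·ʳ : ∀ {t s} → SNᵃ (t · s) → SNᵃ s
SNᵃ-·ʳ {t} = SNᵃ-preimage (t ·_) ξ-·₂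

SNᵃ-throw⁻ : ∀ {a t} → SNᵃ (throw a t) → SNᵃ t
SNᵃ-throw⁻ {a} = SNᵃ-preimage (throw a) ξ-throw

SNᵃ-throw : ∀ {a t} → SNᵃ t → SNᵃ (throw a t)
SNᵃ-throw sn@(acc h) = acc λ { throwT → sn ; (ξ-throw r) → SNᵃ-throw (h r) }

data ThrowHeaded : Term → Set where
  throw-head : ∀ {a t} → ThrowHeaded (throw a t)
  applied    : ∀ {t s} → ThrowHeaded t → ThrowHeaded (t · s)

ThrowHeaded⇒¬Value : ∀ {t} → ThrowHeaded t → ¬ Value t
ThrowHeaded⇒¬Value (applied th) (v-cons1 _)   = ThrowHeaded⇒¬Value th v-cons0
ThrowHeaded⇒¬Value (applied th) (v-cons2 p _) = ThrowHeaded⇒¬Value th (v-cons1 p)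
ThrowHeaded⇒¬Value (applied th) (v-lrec1 _)   = ThrowHeaded⇒¬Value th v-lrec0
ThrowHeaded⇒¬Value (applied th) (v-lrec2 p _) = ThrowHeaded⇒¬Value th (v-lrec1 p)

ThrowHeaded-⟶ : ∀ {t u} → ThrowHeaded t → t ⟶ u → ThrowHeaded u
ThrowHeaded-⟶ throw-head throwT       = throw-head
ThrowHeaded-⟶ throw-head (ξ-throw r)  = throw-head
ThrowHeaded-⟶ (applied ()) (β _)
ThrowHeaded-⟶ (applied th) throwL     = throw-head
ThrowHeaded-⟶ (applied th) (throwR v) = ⊥-elim (ThrowHeaded⇒¬Value th v)
ThrowHeaded-⟶ (applied (applied (applied ()))) (lrecNil _ _)
ThrowHeaded-⟶ (applied (applied (applied ()))) (lrecCons _ _ _ _)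
ThrowHeaded-⟶ (applied th) (ξ-·₁ r)   = applied (ThrowHeaded-⟶ th r)
ThrowHeaded-⟶ (applied th) (ξ-·₂ r)   = applied th

ThrowHeaded-⟶* : ∀ {t u} → ThrowHeaded t → t ⟶* u → ThrowHeaded u
ThrowHeaded-⟶* th ε       = th
ThrowHeaded-⟶* th (r ◅ p) = ThrowHeaded-⟶* (ThrowHeaded-⟶ th r) p

¬ThrowHeaded-pair : ∀ {v w} → ¬ ThrowHeaded (v ∷ₜ w)
¬ThrowHeaded-pair (applied (applied ()))

-- Reducibility candidates

-- Terms that may create a root redex when applied to an argument (throwL makes throw one of them).
data NonNeutral : Term → Set where
  nn-lam   : ∀ {t} → NonNeutral (ƛ t)
  nn-throw : ∀ {a t} → NonNeutral (throw a t)
  nn-cons0 : NonNeutral cons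
  nn-cons1 : ∀ {v} → NonNeutral (cons · v)
  nn-cons2 : ∀ {v w} → NonNeutral (cons · v · w)
  nn-lrec0 : NonNeutral lrec
  nn-lrec1 : ∀ {v} → NonNeutral (lrec · v)
  nn-lrec2 : ∀ {v w} → NonNeutral (lrec · v · w)

Neutral : Term → Set
Neutral t = ¬ NonNeutral t

Neutral-· : ∀ {t s} → Neutral t → Neutral (t · s)
Neutral-· n nn-cons1 = n nn-cons0
Neutral-· n nn-cons2 = n nn-cons1
Neutral-· n nn-lrec1 = n nn-lrec0
Neutral-· n nn-lrec2 = n nn-lrec1

L-⟶ : ∀ {S t u} → L S t → t ⟶ u → L S u
L-⟶ (mkL h) r = mkL λ v w vv vw (n , s) → h v w vv vw (suc n , step r s)

L-⟶* : ∀ {S t u} → L S t → t ⟶* u → L S u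
L-⟶* l ε       = l
L-⟶* l (r ◅ p) = L-⟶* (L-⟶ l r) p

L-mono : ∀ {S S' : Term → Set} → (∀ {v} → S v → S' v) → ∀ {t} → L S t → L S' t
L-mono f (mkL h) = mkL λ v w vv vw p → let sv , lw = h v w vv vw p in f sv , L-mono f lw

Red : Ty → Term → Set
Red unit     t = SNᵃ t
Red (list σ) t = SNᵃ t × L (Red σ) t
Red (σ ⇒ τ)  t = ∀ s → Red σ s → Red τ (t · s)

Red-⟶ : ∀ τ {t u} → Red τ t → t ⟶ u → Red τ u
Red-⟶ unit     (acc h)     r      = h r
Red-⟶ (list τ) (acc h , l) r      = h r , L-⟶ l r
Red-⟶ (σ ⇒ τ)  f           r s rs = Red-⟶ τ (f s rs) (ξ-·₁ r)

Red-⟶* : ∀ τ {t u} → Red τ t → t ⟶* u → Red τ u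
Red-⟶* τ rt ε       = rt
Red-⟶* τ rt (r ◅ p) = Red-⟶* τ (Red-⟶ τ rt r) p

mutual
  Red⇒SNᵃ : ∀ τ {t} → Red τ t → SNᵃ t
  Red⇒SNᵃ unit     r = r
  Red⇒SNᵃ (list τ) r = proj₁ r
  Red⇒SNᵃ (σ ⇒ τ)  r = SNᵃ-·ˡ (Red⇒SNᵃ τ (r (var 0) (Red-var σ)))

  Red-var : ∀ σ {i} → Red σ (var i)
  Red-var σ = Red-neutral σ (λ ()) (λ ())

  Red-neutral : ∀ τ {t} → Neutral t → (∀ {u} → t ⟶ u → Red τ u) → Red τ t
  Red-neutral unit     n h = acc h
  Red-neutral (list τ) n h = acc (proj₁ ∘ h) , mkL (L-neutral n h)
  Red-neutral (σ ⇒ τ)  n h s rs = Red-neutral· σ τ n h (Red⇒SNᵃ σ rs) rs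

  L-neutral : ∀ {τ t} → Neutral t → (∀ {u} → t ⟶ u → Red (list τ) u) →
              ∀ v w → Value v → Value w → t ↠ (v ∷ₜ w) → Red τ v × L (Red τ) w
  L-neutral n h v w vv vw (zero , done) = ⊥-elim (n nn-cons2)
  L-neutral n h v w vv vw (suc k , step r s) with proj₂ (h r)
  ... | mkL g = g v w vv vw (k , s)

  Red-neutral· : ∀ σ τ {t} → Neutral t → (∀ {u} → t ⟶ u → Red (σ ⇒ τ) u) →
                 ∀ {s} → SNᵃ s → Red σ s → Red τ (t · s)
  Red-neutral· σ τ n h sn@(acc g) rs = Red-neutral τ (Neutral-· n) λ
    { (β _)              → ⊥-elim (n nn-lam)
    ; throwL             → ⊥-elim (n nn-throw)
    ; (throwR _)         → Red-throw τ (SNᵃ-throw⁻ sn)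
    ; (lrecNil _ _)      → ⊥-elim (n nn-lrec2)
    ; (lrecCons _ _ _ _) → ⊥-elim (n nn-lrec2)
    ; (ξ-·₁ r)           → h r _ rs
    ; (ξ-·₂ r)           → Red-neutral· σ τ n h (g r) (Red-⟶ σ rs r)
    }

  Red-throw : ∀ τ {a t} → SNᵃ t → Red τ (throw a t)
  Red-throw unit     sn = SNᵃ-throw sn
  Red-throw (list τ) sn =
    SNᵃ-throw sn , mkL λ v w vv vw p → ⊥-elim (¬ThrowHeaded-pair (ThrowHeaded-⟶* throw-head (↠⇒⟶* p)))
  Red-throw (σ ⇒ τ)  sn s rs = Red-throw· σ τ (SNᵃ-throw sn) (Red⇒SNᵃ σ rs) rs

  Red-throw· : ∀ σ τ {a t s} → SNᵃ (throw a t) → SNᵃ s → Red σ s → Red τ (throw a t · s)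
  Red-throw· σ τ snt@(acc h) sns@(acc g) rs = Red-neutral τ (λ ()) λ
    { throwL             → Red-throw τ (SNᵃ-throw⁻ snt)
    ; (throwR ())
    ; (ξ-·₁ throwT)      → Red-throw· σ τ (h throwT) sns rs
    ; (ξ-·₁ (ξ-throw r)) → Red-throw· σ τ (h (ξ-throw r)) sns rs
    ; (ξ-·₂ r)           → Red-throw· σ τ snt (g r) (Red-⟶ σ rs r)
    }

Red⇒⟦⟧ : ∀ τ {t} → Red τ t → ⟦ τ ⟧ t
⟦⟧⇒Red : ∀ τ {t} → ⟦ τ ⟧ t → Red τ t
Red⇒⟦⟧ unit     sn       = SNᵃ⇒SN sn
Red⇒⟦⟧ (list τ) (sn , l) = SNᵃ⇒SN sn , L-mono (Red⇒⟦⟧ τ) l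
Red⇒⟦⟧ (σ ⇒ τ)  f s ⟦s⟧  = Red⇒⟦⟧ τ (f s (⟦⟧⇒Red σ ⟦s⟧))
⟦⟧⇒Red unit     sn       = SN⇒SNᵃ sn
⟦⟧⇒Red (list τ) (sn , l) = SN⇒SNᵃ sn , L-mono (⟦⟧⇒Red τ) l
⟦⟧⇒Red (σ ⇒ τ)  f s rs   = ⟦⟧⇒Red τ (f s (Red⇒⟦⟧ σ rs))

-- catchSame turns catch (throw 0 t) into catch t just as throwT turns throw 0 (throw 0 t) into throw 0 t.
SNᵃ-catch : ∀ {t} → SNᵃ t → SNᵃ (catch t)
SNᵃ-catch = go ∘ SNᵃ-throw
  where
  go : ∀ {t} → SNᵃ (throw 0 t) → SNᵃ (catch t)
  go sn@(acc h) = acc λ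
    { (ξ-catch r)    → go (h (ξ-throw r))
    ; catchSame      → go (h throwT)
    ; (catchOther _) → SNᵃ-throw (SNᵃ-cren⁻ suc (SNᵃ-throw⁻ (SNᵃ-throw⁻ sn)))
    ; (catchVal _)   → SNᵃ-cren⁻ suc (SNᵃ-throw⁻ sn)
    }

data NeverPair : Term → Set where
  np-var   : ∀ {i} → NeverPair (var i)
  np-unit  : NeverPair ⟨⟩
  np-nil   : NeverPair nil
  np-cons0 : NeverPair cons
  np-cons1 : ∀ {t} → NeverPair (cons · t)
  np-lrec0 : NeverPair lrec
  np-lrec1 : ∀ {t} → NeverPair (lrec · t)
  np-lrec2 : ∀ {t s} → NeverPair (lrec · t · s)
  np-lam   : ∀ {t} → NeverPair (ƛ t)
  np-throw : ∀ {t} → ThrowHeaded t → NeverPair t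

NeverPair-⟶ : ∀ {t u} → NeverPair t → t ⟶ u → NeverPair u
NeverPair-⟶ np-cons1     (throwR _)        = np-throw throw-head
NeverPair-⟶ np-cons1     (ξ-·₂ r)          = np-cons1
NeverPair-⟶ np-lrec1     (throwR _)        = np-throw throw-head
NeverPair-⟶ np-lrec1     (ξ-·₂ r)          = np-lrec1
NeverPair-⟶ np-lrec2     (throwR _)        = np-throw throw-head
NeverPair-⟶ np-lrec2     (ξ-·₁ (throwR _)) = np-throw (applied throw-head)
NeverPair-⟶ np-lrec2     (ξ-·₁ (ξ-·₂ r))   = np-lrec2
NeverPair-⟶ np-lrec2     (ξ-·₂ r)          = np-lrec2
NeverPair-⟶ np-lam       (ξ-ƛ r)           = np-lam
NeverPair-⟶ (np-throw th) r                = np-throw (ThrowHeaded-⟶ th r)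

NeverPair-¬⟶*-pair : ∀ {t v w} → NeverPair t → ¬ (t ⟶* v ∷ₜ w)
NeverPair-¬⟶*-pair (np-throw th) ε       = ¬ThrowHeaded-pair th
NeverPair-¬⟶*-pair np            (r ◅ p) = NeverPair-¬⟶*-pair (NeverPair-⟶ np r) p

pair-⟶*-pair : ∀ {x c v w} → x ∷ₜ c ⟶* v ∷ₜ w → x ⟶* v × c ⟶* w
pair-⟶*-pair ε                     = ε , ε
pair-⟶*-pair (ξ-·₁ (ξ-·₂ r) ◅ p)   = let px , pc = pair-⟶*-pair p in r ◅ px , pc
pair-⟶*-pair (ξ-·₂ r ◅ p)          = let px , pc = pair-⟶*-pair p in px , r ◅ pc
pair-⟶*-pair (ξ-·₁ (throwR _) ◅ p) = ⊥-elim (NeverPair-¬⟶*-pair (np-throw (applied throw-head)) p)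
pair-⟶*-pair (throwR _ ◅ p)        = ⊥-elim (NeverPair-¬⟶*-pair (np-throw throw-head) p)

-- For arrow-free ψ the condition L (Red ψ) only asks for strong normalisation of the list elements;
-- the tail of a value is a smaller value, which makes the inductive definition of L go through.
mutual
  Red-arrowFree : ∀ {ψ} → ArrowFree ψ → ∀ {t} → SNᵃ t → Red ψ t
  Red-arrowFree af-unit     sn = sn
  Red-arrowFree (af-list a) sn = sn , mkL λ v w vv vw p →
    let sn-vw = SNᵃ-⟶* sn (↠⇒⟶* p) in
    Red-arrowFree a (SNᵃ-·ʳ (SNᵃ-·ˡ sn-vw)) , L-arrowFree-value a vw (SNᵃ-·ʳ sn-vw) ε

  L-arrowFree-value : ∀ {ψ b u} → ArrowFree ψ → Value b → SNᵃ b → b ⟶* u → L (Red ψ) u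
  L-arrowFree-value a vb sn p = mkL λ v w _ _ q → pair-reduct a vb sn (p ◅◅ ↠⇒⟶* q)

  pair-reduct : ∀ {ψ b v w} → ArrowFree ψ → Value b → SNᵃ b → b ⟶* v ∷ₜ w → Red ψ v × L (Red ψ) w
  pair-reduct a (v-cons2 _ vc) sn p =
    let px , pc = pair-⟶*-pair p in
    Red-arrowFree a (SNᵃ-⟶* (SNᵃ-·ʳ (SNᵃ-·ˡ sn)) px) , L-arrowFree-value a vc (SNᵃ-·ʳ sn) pc
  pair-reduct a (v-var _)     sn p = ⊥-elim (NeverPair-¬⟶*-pair np-var p)
  pair-reduct a v-unit        sn p = ⊥-elim (NeverPair-¬⟶*-pair np-unit p)
  pair-reduct a v-nil         sn p = ⊥-elim (NeverPair-¬⟶*-pair np-nil p)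
  pair-reduct a v-cons0       sn p = ⊥-elim (NeverPair-¬⟶*-pair np-cons0 p)
  pair-reduct a (v-cons1 _)   sn p = ⊥-elim (NeverPair-¬⟶*-pair np-cons1 p)
  pair-reduct a v-lrec0       sn p = ⊥-elim (NeverPair-¬⟶*-pair np-lrec0 p)
  pair-reduct a (v-lrec1 _)   sn p = ⊥-elim (NeverPair-¬⟶*-pair np-lrec1 p)
  pair-reduct a (v-lrec2 _ _) sn p = ⊥-elim (NeverPair-¬⟶*-pair np-lrec2 p)
  pair-reduct a (v-lam _)     sn p = ⊥-elim (NeverPair-¬⟶*-pair np-lam p)

Red-nil : ∀ σ → Red (list σ) nil
Red-nil σ = acc (λ ()) , mkL λ { _ _ _ _ (zero , ()) ; _ _ _ _ (suc _ , step () _) }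

SNᵃ-pair : ∀ {t s} → SNᵃ t → SNᵃ s → SNᵃ (t ∷ₜ s)
SNᵃ-pair snt@(acc g) sns@(acc h) = acc λ
  { (ξ-·₁ (ξ-·₂ r))  → SNᵃ-pair (g r) sns
  ; (ξ-·₁ (throwR _)) → Red-throw· unit unit snt sns sns
  ; (ξ-·₂ r)         → SNᵃ-pair snt (h r)
  ; (throwR _)       → sns
  }

Red-pair : ∀ σ {t s} → Red σ t → Red (list σ) s → Red (list σ) (t ∷ₜ s)
Red-pair σ rt rs@(sn , _) = SNᵃ-pair (Red⇒SNᵃ σ rt) sn , mkL λ v w _ _ p →
  let pt , ps = pair-⟶*-pair (↠⇒⟶* p) in
  Red-⟶* σ rt pt , proj₂ (Red-⟶* (list σ) rs ps)

Red-ƛ : ∀ σ τ u → (∀ v → Value v → Red σ v → Red τ (u [0:= v ])) → Red (σ ⇒ τ) (ƛ u)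
Red-ƛ σ τ u body s rs =
  go (SNᵃ-[0:=]⁻ (v-var 0) (Red⇒SNᵃ τ (body (var 0) (v-var 0) (Red-var σ)))) body (Red⇒SNᵃ σ rs) rs
  where
  go : ∀ {u s} → SNᵃ u → (∀ v → Value v → Red σ v → Red τ (u [0:= v ])) →
       SNᵃ s → Red σ s → Red τ (ƛ u · s)
  go snu@(acc g) body sns@(acc h) rs = Red-neutral τ (λ ()) λ
    { (β vs)           → body _ vs rs
    ; (throwR _)       → Red-throw τ (SNᵃ-throw⁻ sns)
    ; (ξ-·₁ (ξ-ƛ r))   → go (g r) (λ v vv rv → Red-⟶ τ (body v vv rv) ([0:=]-⟶ vv r)) sns rs
    ; (ξ-·₂ r)         → go snu body (h r) (Red-⟶ σ rs r)
    }

-- Induction on the L-proof for a fixed list l₀ (lrecCons descends to its tail) and on the accessibility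
-- of the arguments; the list argument itself is any reduct of l₀.
Red-lrec : ∀ ρ σ → Red (ρ ⇒ (σ ⇒ list σ ⇒ ρ ⇒ ρ) ⇒ list σ ⇒ ρ) lrec
Red-lrec ρ σ r rr f rf l (snl , Ll) = go Ll ε snl (Red⇒SNᵃ ρ rr) (Red⇒SNᵃ F rf) rr rf
  where
  F : Ty
  F = σ ⇒ list σ ⇒ ρ ⇒ ρ

  go : ∀ {l₀ l r f} → L (Red σ) l₀ → l₀ ⟶* l → SNᵃ l → SNᵃ r → SNᵃ f → Red ρ r → Red F f →
       Red ρ (lrec · r · f · l)
  go {l₀} {l} {r} {f} L₀ p snl@(acc gl) snr@(acc gr) snf@(acc gf) rr rf = Red-neutral ρ (λ ()) λ
    { (ξ-·₁ (ξ-·₁ (ξ-·₂ st))) → go L₀ p snl (gr st) snf (Red-⟶ ρ rr st) rf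
    ; (ξ-·₁ (ξ-·₁ (throwR _))) → Red-throw (F ⇒ list σ ⇒ ρ) (SNᵃ-throw⁻ snr) f rf l (snl , L-⟶* L₀ p)
    ; (ξ-·₁ (ξ-·₂ st))        → go L₀ p snl snr (gf st) rr (Red-⟶ F rf st)
    ; (ξ-·₁ (throwR _))       → Red-throw (list σ ⇒ ρ) (SNᵃ-throw⁻ snf) l (snl , L-⟶* L₀ p)
    ; (ξ-·₂ st)               → go L₀ (p ◅◅ st ◅ ε) (gl st) snr snf rr rf
    ; (throwR _)              → Red-throw ρ (SNᵃ-throw⁻ snl)
    ; (lrecNil _ _)           → rr
    ; (lrecCons _ _ vvh vvt)  → step-cons L₀ p snl vvh vvt
    }
    where
    step-cons : ∀ {vh vt} → L (Red σ) l₀ → l₀ ⟶* vh ∷ₜ vt → SNᵃ (vh ∷ₜ vt) → Value vh → Value vt →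
                Red ρ (f · vh · vt · (lrec · r · f · vt))
    step-cons {vh} {vt} (mkL h) p snl vvh vvt =
      let rvh , Lvt = h vh vt vvh vvt (⟶*⇒↠ p) in
      rf vh rvh vt (SNᵃ-·ʳ snl , Lvt) _ (go Lvt ε (SNᵃ-·ʳ snl) snr snf rr rf)

-- Renaming continuation variables

Inverses : (ℕ → ℕ) → (ℕ → ℕ) → Set
Inverses f g = (g ∘ f ≗ id) × (f ∘ g ≗ id)

cren-inverse : ∀ {f g} → Inverses f g → ∀ t → cren g (cren f t) ≡ t
cren-inverse {f} {g} (gf , _) t = trans (cren-cren g f t) (cren-id gf t)

SNᵃ-cren-bijection : ∀ {f g} → Inverses f g → ∀ {t} → SNᵃ t → SNᵃ (cren f t)
SNᵃ-cren-bijection {f} {g} inv {t} (acc h) = acc λ {u} r →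
  subst SNᵃ (cren-inverse (swap inv) u)
    (SNᵃ-cren-bijection inv (h (subst (_⟶ cren g u) (cren-inverse inv t) (cren-⟶ g r))))

L-cren-bijection : ∀ {f g} → Inverses f g → ∀ {S : Term → Set} → (∀ {v} → S v → S (cren f v)) →
                   ∀ {t} → L S t → L S (cren f t)
L-cren-bijection {f} {g} inv {S} S-cren {t} (mkL h) = mkL λ v w vv vw p →
  let sv , lw = h (cren g v) (cren g w) (Value-cren g vv) (Value-cren g vw) (⟶*⇒↠ (back p)) in
  subst S (cren-inverse (swap inv) v) (S-cren sv) ,
  subst (L S) (cren-inverse (swap inv) w) (L-cren-bijection inv S-cren lw)
  where
  back : ∀ {v w} → cren f t ↠ v ∷ₜ w → t ⟶* cren g v ∷ₜ cren g w
  back p = subst (_⟶* _) (cren-inverse inv t) (gmap (cren g) (cren-⟶ g) (↠⇒⟶* p))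

Red-cren-bijection : ∀ τ {f g} → Inverses f g → ∀ {t} → Red τ t → Red τ (cren f t)
Red-cren-bijection unit     inv sn       = SNᵃ-cren-bijection inv sn
Red-cren-bijection (list τ) inv (sn , l) =
  SNᵃ-cren-bijection inv sn , L-cren-bijection inv (Red-cren-bijection τ inv) l
Red-cren-bijection (σ ⇒ τ) {f} {g} inv {t} rt s rs =
  subst (λ s → Red τ (cren f t · s)) (cren-inverse (swap inv) s)
    (Red-cren-bijection τ inv (rt (cren g s) (Red-cren-bijection σ (swap inv) rs)))

fcvBound : Term → ℕ
fcvBound (var i)     = 0
fcvBound ⟨⟩          = 0
fcvBound nil         = 0
fcvBound cons        = 0
fcvBound lrec        = 0
fcvBound (ƛ t)       = fcvBound t
fcvBound (t · s)     = fcvBound t ⊔ fcvBound s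
fcvBound (catch t)   = fcvBound t
fcvBound (throw a t) = suc a ⊔ fcvBound t

cren-cong-below : ∀ N {f g} → (∀ i → i < N → f i ≡ g i) → ∀ t → fcvBound t ≤ N → cren f t ≡ cren g t
cren-cong-below N e (var i)     _ = refl
cren-cong-below N e ⟨⟩          _ = refl
cren-cong-below N e nil         _ = refl
cren-cong-below N e cons        _ = refl
cren-cong-below N e lrec        _ = refl
cren-cong-below N e (ƛ t)       b = cong ƛ (cren-cong-below N e t b)
cren-cong-below N e (t · s)     b =
  cong₂ _·_ (cren-cong-below N e t (≤-trans (m≤m⊔n _ _) b)) (cren-cong-below N e s (≤-trans (m≤n⊔m _ _) b))
cren-cong-below N {f} {g} e (catch t) b = cong catch (cren-cong-below N e' t b)
  where
  e' : ∀ i → i < N → ext f i ≡ ext g i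
  e' zero    _ = refl
  e' (suc i) i<N = cong suc (e i (≤-trans (n≤1+n _) i<N))
cren-cong-below N e (throw a t) b =
  cong₂ throw (e a (≤-trans (m≤m⊔n (suc a) (fcvBound t)) b)) (cren-cong-below N e t (≤-trans (m≤n⊔m _ _) b))

rotate : ℕ → ℕ → ℕ
rotate N i with <-cmp i N
... | tri< _ _ _ = suc i
... | tri≈ _ _ _ = 0
... | tri> _ _ _ = i

rotate⁻¹ : ℕ → ℕ → ℕ
rotate⁻¹ N zero    = N
rotate⁻¹ N (suc j) with j <? N
... | yes _ = j
... | no  _ = suc j

rotate-below : ∀ N i → i < N → rotate N i ≡ suc i
rotate-below N i i<N with <-cmp i N
... | tri< _ _ _   = refl
... | tri≈ i≮N _ _ = ⊥-elim (i≮N i<N)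
... | tri> i≮N _ _ = ⊥-elim (i≮N i<N)

rotate-inverse : ∀ N → Inverses (rotate N) (rotate⁻¹ N)
rotate-inverse N = left , right
  where
  left : ∀ i → rotate⁻¹ N (rotate N i) ≡ i
  left i with <-cmp i N
  left i | tri< i<N _ _ with i <? N
  ... | yes _   = refl
  ... | no i≮N  = ⊥-elim (i≮N i<N)
  left i | tri≈ _ i≡N _ = sym i≡N
  left zero    | tri> _ _ ()
  left (suc j) | tri> _ _ N<1+j with j <? N
  ... | yes j<N = ⊥-elim (<⇒≱ j<N (≤-pred N<1+j))
  ... | no  _   = refl

  right : ∀ j → rotate N (rotate⁻¹ N j) ≡ j
  right zero with <-cmp N N
  ... | tri< N<N _ _ = ⊥-elim (<-irrefl refl N<N)
  ... | tri≈ _ _ _   = refl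
  ... | tri> _ _ N<N = ⊥-elim (<-irrefl refl N<N)
  right (suc k) with k <? N
  ... | yes k<N = rotate-below N k k<N
  ... | no k≮N with <-cmp (suc k) N
  ...   | tri< 1+k<N _ _ = ⊥-elim (k≮N (≤-trans (n≤1+n _) 1+k<N))
  ...   | tri≈ _ 1+k≡N _ = ⊥-elim (k≮N (subst (k <_) 1+k≡N ≤-refl))
  ...   | tri> _ _ _     = refl

-- Reducibility is not transported along the non-surjective cren suc directly; on t it agrees with
-- the bijection rotate (fcvBound t).
Red-cren-suc : ∀ τ {t} → Red τ t → Red τ (cren suc t)
Red-cren-suc τ {t} rt =
  subst (Red τ) (cren-cong-below N (rotate-below N) t ≤-refl)
    (Red-cren-bijection τ {g = rotate⁻¹ N} (rotate-inverse N) rt)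
  where
  N : ℕ
  N = fcvBound t

fundamental : ∀ {Γ Δ t τ} → Γ ⨾ Δ ⊢ t ∶ τ →
              ∀ γ → (∀ {i ρ} → Γ ∋ i ∶ ρ → Red ρ (γ i)) → Red τ (sub γ t)
fundamental (⊢var x)   γ rγ = rγ x
fundamental ⊢unit      γ rγ = acc λ ()
fundamental ⊢nil       γ rγ = Red-nil _
fundamental ⊢cons      γ rγ = λ _ rt _ rs → Red-pair _ rt rs
fundamental ⊢lrec      γ rγ = Red-lrec _ _
fundamental (⊢lam {σ} {τ} {t} d) γ rγ =
  Red-ƛ σ τ (sub (exts γ) t) λ v _ rv →
    subst (Red τ) (sym (sub-exts-[0:=] γ t v)) (fundamental d (v ∷ₛ γ) λ { here → rv ; (there x) → rγ x })
fundamental (⊢app d e) γ rγ = fundamental d γ rγ _ (fundamental e γ rγ)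
fundamental (⊢catch {ψ} af d) γ rγ =
  Red-arrowFree af (SNᵃ-catch (Red⇒SNᵃ ψ (fundamental d (cren suc ∘ γ) (Red-cren-suc _ ∘ rγ))))
fundamental (⊢throw {ψ} d _) γ rγ = Red-throw _ (Red⇒SNᵃ ψ (fundamental d γ rγ))

∋⇒< : ∀ {Γ i ρ} → Γ ∋ i ∶ ρ → i < length Γ
∋⇒< here      = s≤s z≤n
∋⇒< (there x) = s≤s (∋⇒< x)

∋⇒lookup : ∀ {Γ i ρ} → Γ ∋ i ∶ ρ → (i<n : i < length Γ) → lookup Γ (fromℕ< i<n) ≡ ρ
∋⇒lookup here      _   = refl
∋⇒lookup (there x) i<n = ∋⇒lookup x (≤-pred i<n)

Red-simSubst : ∀ {Γ} {rs : Fin (length Γ) → Term} → (∀ j → Red (lookup Γ j) (rs j)) →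
               ∀ {i ρ} → Γ ∋ i ∶ ρ → Red ρ (simSubst rs i)
Red-simSubst {Γ} {rs} rrs {i} x with i <? length Γ
... | yes i<n = subst (λ ρ → Red ρ (rs (fromℕ< i<n))) (∋⇒lookup x i<n) (rrs (fromℕ< i<n))
... | no  i≮n = ⊥-elim (i≮n (∋⇒< x))

corollary4p17 : (Γ Δ : List Ty) → All ArrowFree Δ → (t : Term) → (τ : Ty) →
    Γ ⨾ Δ ⊢ t ∶ τ →
    (rs : Fin (length Γ) → Term) → (∀ i → ⟦ lookup Γ i ⟧ (rs i)) →
    ⟦ τ ⟧ (sub (simSubst rs) t)
corollary4p17 Γ Δ _ t τ d rs ⟦rs⟧ =
  Red⇒⟦⟧ τ (fundamental d (simSubst rs) (Red-simSubst (⟦⟧⇒Red _ ∘ ⟦rs⟧)))
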